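{- Let $n\geq 4$ be an even integer, $k\geq 3$ and $m\geq 2$ integers. Then the minimum size of a resolving set of vertices of $(C_n\Box P_k)\Box P_m$ is $4$, i.e. $\beta((C_n\Box P_k)\Box P_m)=4$.
   Context: $C_n$ denotes the cycle on $n$ vertices and $P_k$, $P_m$ the paths on $k$ and $m$ vertices. For graphs $G,H$, the Cartesian product $G\Box H$ has vertex set $V(G)\times V(H)$, with $(g_1,h_1)$ adjacent to $(g_2,h_2)$ iff either $h_1=h_2$ and $g_1g_2\in E(G)$, or $g_1=g_2$ and $h_1h_2\in E(H)$. For a connected graph $G$ and an ordered set $Q=\{q_1,\dots,q_l\}\subseteq V(G)$, $r(x|Q)=(d(x,q_1),\dots,d(x,q_l))$, where $d$ is the shortest-path distance. $Q$ is a resolving set if distinct vertices have distinct representations $r(\cdot|Q)$. $\beta(G)$ is the minimum size of a resolving set of $G$. -}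

module Defs where

open import Data.Nat using (ℕ; zero; suc; _+_; _≤_; _%_; NonZero)
open import Data.Fin using (Fin; toℕ)
open import Data.Product using (_×_; _,_; Σ)
open import Data.Sum using (_⊎_)
open import Data.List using (List; length)
open import Data.List.Membership.Propositional using (_∈_)
open import Relation.Binary.PropositionalEquality using (_≡_)

record Graph : Set₁ where
  field
    V   : Set
    Adj : V → V → Set
open Graph public

Cycle : (n : ℕ) → .{{NonZero n}} → Graph
Cycle n = record
  { V = Fin n
  ; Adj = λ i j → ((suc (toℕ i)) % n ≡ toℕ j) ⊎ ((suc (toℕ j)) % n ≡ toℕ i) }

Path : ℕ → Graph
Path k = record
  { V = Fin k
  ; Adj = λ i j → (suc (toℕ i) ≡ toℕ j) ⊎ (suc (toℕ j) ≡ toℕ i) }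

_□_ : Graph → Graph → Graph
G □ H = record
  { V = V G × V H
  ; Adj = λ { (g₁ , h₁) (g₂ , h₂) →
      (h₁ ≡ h₂ × Adj G g₁ g₂) ⊎ (g₁ ≡ g₂ × Adj H h₁ h₂) } }
infixl 6 _□_

data Walk (G : Graph) : V G → V G → ℕ → Set where
  here : ∀ {x} → Walk G x x zero
  step : ∀ {x y z ℓ} → Adj G x y → Walk G y z ℓ → Walk G x z (suc ℓ)

Dist : (G : Graph) → V G → V G → ℕ → Set
Dist G x y ℓ = Walk G x y ℓ × (∀ j → Walk G x y j → ℓ ≤ j)

Resolving : (G : Graph) → List (V G) → Set
Resolving G Q =
  ∀ x y → (∀ q → q ∈ Q → ∀ a b → Dist G x q a → Dist G y q b → a ≡ b) → x ≡ y

MetricDimension : Graph → ℕ → Set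
MetricDimension G β =
  (Σ (List (V G)) λ Q → length Q ≡ β × Resolving G Q)
  × (∀ Q → Resolving G Q → β ≤ length Q)

-- Along every edge of (C_n □ P_k) □ P_m the distance to any vertex changes by exactly one
-- (n is even), and that distance is the cyclic distance plus the two path distances.
-- Four landmarks suffice: (0,0,0), (0,0,M), (0,K,0) give the sums u + z, u + (M - z) and
-- u' + y, u' + (K - y), which determine z and y, and (0,0,0), (1,0,0) give the distances
-- of the cycle coordinate to two adjacent vertices, which determine it on an even cycle.
-- Three never suffice. A landmark v off the corners of the k × m rectangle has five
-- neighbours; each is at distance 1 from v and is one closer or one farther from each of
-- the other two landmarks, so two of them share all three distances. If all three
-- landmarks are corners, the first being (a₁, s₁, t₁), twins are found among the neighbours
-- of (a₁, 1, t₁), except in one configuration, where two vertices reached from it by the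
-- same two kinds of steps taken in opposite orders are twins.
module Submission where

open import Data.Bool using (Bool; true; false; not; _xor_)
open import Data.Bool.Properties using (¬-not; not-injective; xor-same) renaming (_≟_ to _≟ᵇ_)
open import Data.Empty using (⊥-elim)
open import Data.Nat
open import Data.Nat.Properties
open import Data.Nat.Divisibility using (_∣_; divides)
open import Data.Nat.DivMod using (m<n⇒m%n≡m; n%n≡0; m%n<n)
open import Data.Fin using (Fin; toℕ; fromℕ<; fromℕ; inject₁; splitAt; join; combine)
  renaming (zero to fzero; suc to fsuc)
open import Data.Fin.Properties
  using (toℕ<n; toℕ-injective; toℕ-fromℕ<; toℕ-fromℕ; toℕ-inject₁; join-splitAt; combine-injective; pigeonhole)
  renaming (<⇒≢ to <⇒≢ᶠ)
open import Data.List using (List; []; _∷_; length)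
open import Data.List.Relation.Unary.Any using (here; there)
open import Data.List.Membership.Propositional using (_∈_)
open import Function.Definitions using (Injective)
open import Data.Product using (Σ; _×_; _,_; proj₁; proj₂)
open import Data.Sum using (_⊎_; inj₁; inj₂; swap; [_,_]′)
open import Relation.Binary.PropositionalEquality
open import Relation.Nullary using (¬_; yes; no)
open import Relation.Binary using (tri<; tri≈; tri>)
open import Function using (_∘_; id)

open import Defs

OneApart : ℕ → ℕ → Set
OneApart a b = suc a ≡ b ⊎ suc b ≡ a

rises? : ∀ {a b} → OneApart a b → Bool
rises? (inj₁ _) = true
rises? (inj₂ _) = false

OneApart-+ʳ : ∀ {a b} c → OneApart a b → OneApart (a + c) (b + c)
OneApart-+ʳ c (inj₁ refl) = inj₁ refl
OneApart-+ʳ c (inj₂ refl) = inj₂ refl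

OneApart-+ˡ : ∀ {a b} c → OneApart a b → OneApart (c + a) (c + b)
OneApart-+ˡ {a} c (inj₁ refl) = inj₁ (sym (+-suc c a))
OneApart-+ˡ {_} {b} c (inj₂ refl) = inj₂ (sym (+-suc c b))

rises?-+ʳ : ∀ {a b} c (p : OneApart a b) → rises? (OneApart-+ʳ c p) ≡ rises? p
rises?-+ʳ c (inj₁ refl) = refl
rises?-+ʳ c (inj₂ refl) = refl

rises?-+ˡ : ∀ {a b} c (p : OneApart a b) → rises? (OneApart-+ˡ c p) ≡ rises? p
rises?-+ˡ c (inj₁ refl) = refl
rises?-+ˡ c (inj₂ refl) = refl

OneApart-sym : ∀ {a b} → OneApart a b → OneApart b a
OneApart-sym = swap

∣-∣-step : ∀ a b → OneApart ∣ a - b ∣ ∣ suc a - b ∣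
∣-∣-step zero zero = inj₁ refl
∣-∣-step zero (suc b) = inj₂ refl
∣-∣-step (suc a) zero = inj₁ refl
∣-∣-step (suc a) (suc b) = ∣-∣-step a b

OneApart⇒≤suc : ∀ {a b} → OneApart a b → a ≤ suc b
OneApart⇒≤suc {a} (inj₁ refl) = m≤n+m a 2
OneApart⇒≤suc (inj₂ refl) = ≤-refl

2+n≢n : ∀ {a} → suc (suc a) ≢ a
2+n≢n {suc a} e = 2+n≢n (suc-injective e)

OneApart-irrefl : ∀ {a} → ¬ OneApart a a
OneApart-irrefl (inj₁ e) = 1+n≢n e
OneApart-irrefl (inj₂ e) = 1+n≢n e

rises?-true : ∀ {a b} (p : OneApart a b) → suc a ≡ b → rises? p ≡ true
rises?-true (inj₁ _) _ = refl
rises?-true (inj₂ refl) e = ⊥-elim (2+n≢n e)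

rises?-false : ∀ {a b} (p : OneApart a b) → suc b ≡ a → rises? p ≡ false
rises?-false (inj₁ refl) e = ⊥-elim (2+n≢n e)
rises?-false (inj₂ _) _ = refl

rises?-from-0 : ∀ {a b} (p : OneApart a b) → a ≡ 0 → rises? p ≡ true
rises?-from-0 (inj₁ _) _ = refl
rises?-from-0 (inj₂ refl) ()

same-rise⇒≡ : ∀ {a b c} (p : OneApart a b) (q : OneApart a c) → rises? p ≡ rises? q → b ≡ c
same-rise⇒≡ (inj₁ refl) (inj₁ refl) _ = refl
same-rise⇒≡ (inj₂ refl) (inj₂ e) _ = suc-injective (sym e)

two-steps-parallel⇒≡ : ∀ {a b c b' c'}
  (p₁ : OneApart a b) (p₂ : OneApart b c) (q₁ : OneApart a b') (q₂ : OneApart b' c') →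
  rises? p₁ ≡ rises? q₁ → rises? p₂ ≡ rises? q₂ → c ≡ c'
two-steps-parallel⇒≡ (inj₁ refl) (inj₁ refl) (inj₁ refl) (inj₁ refl) _ _ = refl
two-steps-parallel⇒≡ (inj₁ refl) (inj₂ refl) (inj₁ refl) (inj₂ e) _ _ = sym (suc-injective e)
two-steps-parallel⇒≡ (inj₂ refl) (inj₁ refl) (inj₂ refl) (inj₁ refl) _ _ = refl
two-steps-parallel⇒≡ (inj₂ refl) (inj₂ refl) (inj₂ e) (inj₂ refl) _ _ = sym (suc-injective (suc-injective e))

two-steps-crossed⇒≡ : ∀ {a b c b' c'}
  (p₁ : OneApart a b) (p₂ : OneApart b c) (q₁ : OneApart a b') (q₂ : OneApart b' c') →
  rises? p₁ ≡ rises? q₂ → rises? p₂ ≡ rises? q₁ → c ≡ c'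
two-steps-crossed⇒≡ (inj₁ refl) (inj₁ refl) (inj₁ refl) (inj₁ refl) _ _ = refl
two-steps-crossed⇒≡ (inj₁ refl) (inj₂ refl) (inj₂ refl) (inj₁ refl) _ _ = refl
two-steps-crossed⇒≡ (inj₂ refl) (inj₁ refl) (inj₁ refl) (inj₂ e) _ _ = sym (suc-injective e)
two-steps-crossed⇒≡ (inj₂ refl) (inj₂ refl) (inj₂ e) (inj₂ refl) _ _ = sym (suc-injective (suc-injective e))

SameSteps : Bool → Bool → Bool → Bool → Set
SameSteps a₁ a₂ b₁ b₂ = (a₁ ≡ b₁ × a₂ ≡ b₂) ⊎ (a₁ ≡ b₂ × a₂ ≡ b₁)

two-steps⇒≡ : ∀ {a b c b' c'}
  (p₁ : OneApart a b) (p₂ : OneApart b c) (q₁ : OneApart a b') (q₂ : OneApart b' c') →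
  SameSteps (rises? p₁) (rises? p₂) (rises? q₁) (rises? q₂) → c ≡ c'
two-steps⇒≡ p₁ p₂ q₁ q₂ (inj₁ (e₁ , e₂)) = two-steps-parallel⇒≡ p₁ p₂ q₁ q₂ e₁ e₂
two-steps⇒≡ p₁ p₂ q₁ q₂ (inj₂ (e₁ , e₂)) = two-steps-crossed⇒≡ p₁ p₂ q₁ q₂ e₁ e₂

-- If z < z' then u' < u by the first sum, which makes the second sum larger on the left.
reflected-sums-≮ : ∀ L {u u' z z'} → u + z ≡ u' + z' → u + (L ∸ z) ≡ u' + (L ∸ z') → z ≮ z'
reflected-sums-≮ L {u} {u'} sum≡ reflected≡ z<z' with u ≤? u'
... | yes u≤u' = <-irrefl sum≡ (+-mono-≤-< u≤u' z<z')
... | no u≰u' = <-irrefl (sym reflected≡) (+-mono-<-≤ (≰⇒> u≰u') (∸-monoʳ-≤ L (<⇒≤ z<z')))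

reflected-sums⇒≡ : ∀ L {u u' z z'} → u + z ≡ u' + z' → u + (L ∸ z) ≡ u' + (L ∸ z') → z ≡ z'
reflected-sums⇒≡ L {z = z} {z'} sum≡ reflected≡ with <-cmp z z'
... | tri< z<z' _ _ = ⊥-elim (reflected-sums-≮ L sum≡ reflected≡ z<z')
... | tri≈ _ z≡z' _ = z≡z'
... | tri> _ _ z>z' = ⊥-elim (reflected-sums-≮ L (sym sum≡) (sym reflected≡) z>z')

xor-exchange : ∀ a b c d → a xor b ≡ c xor d → a xor c ≡ b xor d
xor-exchange false false false false refl = refl
xor-exchange false false true true refl = refl
xor-exchange false true false true refl = refl
xor-exchange false true true false refl = refl
xor-exchange true false false true refl = refl
xor-exchange true false true false refl = refl
xor-exchange true true false false refl = refl
xor-exchange true true true true refl = refl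

≢-≢⇒≡ : ∀ {a b c : Bool} → a ≢ c → b ≢ c → a ≡ b
≢-≢⇒≡ a≢c b≢c = trans (¬-not a≢c) (sym (¬-not b≢c))

∣-∣-to-last : ∀ {L} (y : Fin (suc L)) → ∣ toℕ y - toℕ (fromℕ L) ∣ ≡ L ∸ toℕ y
∣-∣-to-last {L} y = trans (cong (∣ toℕ y -_∣) (toℕ-fromℕ L)) (m≤n⇒∣m-n∣≡n∸m (s≤s⁻¹ (toℕ<n y)))

module _ {G : Graph} where

  _++ᵂ_ : ∀ {x y z a b} → Walk G x y a → Walk G y z b → Walk G x z (a + b)
  here ++ᵂ w = w
  step e v ++ᵂ w = step e (v ++ᵂ w)

  reverseᵂ : (∀ {a b} → Adj G a b → Adj G b a) → ∀ {x y ℓ} → Walk G x y ℓ → Walk G y x ℓ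
  reverseᵂ sym-adj here = here
  reverseᵂ sym-adj (step {ℓ = ℓ} e w) = subst (Walk G _ _) (+-comm ℓ 1) (reverseᵂ sym-adj w ++ᵂ step (sym-adj e) here)

mapᵂ : ∀ {G H : Graph} {f : V G → V H} → (∀ {a b} → Adj G a b → Adj H (f a) (f b)) →
  ∀ {x y ℓ} → Walk G x y ℓ → Walk H (f x) (f y) ℓ
mapᵂ adj here = here
mapᵂ adj (step e w) = step (adj e) (mapᵂ adj w)

module _ {G H : Graph} where

  liftˡᵂ : ∀ {g g' ℓ} h → Walk G g g' ℓ → Walk (G □ H) (g , h) (g' , h) ℓ
  liftˡᵂ h = mapᵂ (λ e → inj₁ (refl , e))

  liftʳᵂ : ∀ {h h' ℓ} g → Walk H h h' ℓ → Walk (G □ H) (g , h) (g , h') ℓ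
  liftʳᵂ g = mapᵂ (λ e → inj₂ (refl , e))

-- Such a function exists exactly for connected bipartite graphs, and it is then the graph distance.
record BipartiteDistance (G : Graph) : Set where
  field
    dist      : V G → V G → ℕ
    dist-self : ∀ x → dist x x ≡ 0
    dist-edge : ∀ {x x'} → Adj G x x' → ∀ q → OneApart (dist x q) (dist x' q)
    geodesic  : ∀ x y → Walk G x y (dist x y)

  dist≤length : ∀ {x y ℓ} → Walk G x y ℓ → dist x y ≤ ℓ
  dist≤length {x} here = ≤-reflexive (dist-self x)
  dist≤length {y = y} (step e w) = ≤-trans (OneApart⇒≤suc (dist-edge e y)) (s≤s (dist≤length w))

  isDist : ∀ x y → Dist G x y (dist x y)
  isDist x y = geodesic x y , λ _ → dist≤length

  Dist⇒≡dist : ∀ {x y ℓ} → Dist G x y ℓ → ℓ ≡ dist x y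
  Dist⇒≡dist {x} {y} (w , minimal) = ≤-antisym (minimal _ (geodesic x y)) (dist≤length w)

  adj-irrefl : ∀ {x} → ¬ Adj G x x
  adj-irrefl {x} e = OneApart-irrefl (dist-edge e x)

  adj⇒≢ : ∀ {x x'} → Adj G x x' → x ≢ x'
  adj⇒≢ e refl = adj-irrefl e

  slope : ∀ {x x'} → Adj G x x' → V G → Bool
  slope e q = rises? (dist-edge e q)

  slope-rises : ∀ {x x'} (e : Adj G x x') q → suc (dist x q) ≡ dist x' q → slope e q ≡ true
  slope-rises e q = rises?-true (dist-edge e q)

  slope-falls : ∀ {x x'} (e : Adj G x x') q → suc (dist x' q) ≡ dist x q → slope e q ≡ false
  slope-falls e q = rises?-false (dist-edge e q)

  slope-from-self : ∀ {x x'} (e : Adj G x x') → slope e x ≡ true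
  slope-from-self {x} e = rises?-from-0 (dist-edge e x) (dist-self x)

module _ where
  open BipartiteDistance

  _⊠_ : ∀ {G H} → BipartiteDistance G → BipartiteDistance H → BipartiteDistance (G □ H)
  dist (dG ⊠ dH) (g , h) (g' , h') = dist dG g g' + dist dH h h'
  dist-self (dG ⊠ dH) (g , h) = cong₂ _+_ (dist-self dG g) (dist-self dH h)
  dist-edge (dG ⊠ dH) (inj₁ (refl , e)) (g , h) = OneApart-+ʳ _ (dist-edge dG e g)
  dist-edge (dG ⊠ dH) (inj₂ (refl , e)) (g , h) = OneApart-+ˡ _ (dist-edge dH e h)
  geodesic (dG ⊠ dH) (g , h) (g' , h') = liftˡᵂ h (geodesic dG g g') ++ᵂ liftʳᵂ g' (geodesic dH h h')

  slope-⊠ˡ : ∀ {G H} (dG : BipartiteDistance G) (dH : BipartiteDistance H) {g g'} (e : Adj G g g') h q →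
    slope (dG ⊠ dH) {g , h} {g' , h} (inj₁ (refl , e)) q ≡ slope dG e (proj₁ q)
  slope-⊠ˡ dG dH e _ (g , h) = rises?-+ʳ _ (dist-edge dG e g)

  slope-⊠ʳ : ∀ {G H} (dG : BipartiteDistance G) (dH : BipartiteDistance H) {h h'} (e : Adj H h h') g q →
    slope (dG ⊠ dH) {g , h} {g , h'} (inj₂ (refl , e)) q ≡ slope dH e (proj₂ q)
  slope-⊠ʳ dG dH e _ (g , h) = rises?-+ˡ _ (dist-edge dH e h)

record Neighbourhood (G : Graph) (v : V G) (k : ℕ) : Set where
  field
    nbr      : Fin k → V G
    adjacent : ∀ i → Adj G v (nbr i)
    distinct : Injective _≡_ _≡_ nbr

Neighbourhood-single : ∀ {G v u} → Adj G v u → Neighbourhood G v 1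
Neighbourhood-single {u = u} e = record
  { nbr = λ _ → u ; adjacent = λ _ → e ; distinct = λ { {fzero} {fzero} _ → refl } }

Neighbourhood-pair : ∀ {G v u w} → Adj G v u → Adj G v w → u ≢ w → Neighbourhood G v 2
Neighbourhood-pair {G} {v} {u} {w} e e' u≢w = record { nbr = nbr ; adjacent = adjacent ; distinct = distinct }
  where
    nbr : Fin 2 → V G
    nbr fzero = u
    nbr (fsuc fzero) = w
    adjacent : ∀ i → Adj G v (nbr i)
    adjacent fzero = e
    adjacent (fsuc fzero) = e'
    distinct : Injective _≡_ _≡_ nbr
    distinct {fzero} {fzero} _ = refl
    distinct {fzero} {fsuc fzero} u≡w = ⊥-elim (u≢w u≡w)
    distinct {fsuc fzero} {fzero} w≡u = ⊥-elim (u≢w (sym w≡u))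
    distinct {fsuc fzero} {fsuc fzero} _ = refl

module _ {G H : Graph} (irreflˡ : ∀ {g} → ¬ Adj G g g) where
  open Neighbourhood

  Neighbourhood-□ : ∀ {g h a b} → Neighbourhood G g a → Neighbourhood H h b → Neighbourhood (G □ H) (g , h) (a + b)
  Neighbourhood-□ {g} {h} {a} {b} NG NH = record
    { nbr = nbr-sum ∘ splitAt a
    ; adjacent = λ i → adjacent-sum (splitAt a i)
    ; distinct = λ e → splitAt-injective (distinct-sum _ _ e)
    }
    where
      nbr-sum : Fin a ⊎ Fin b → V (G □ H)
      nbr-sum = [ (λ i → nbr NG i , h) , (λ j → g , nbr NH j) ]′
      adjacent-sum : ∀ s → Adj (G □ H) (g , h) (nbr-sum s)
      adjacent-sum (inj₁ i) = inj₁ (refl , adjacent NG i)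
      adjacent-sum (inj₂ j) = inj₂ (refl , adjacent NH j)
      distinct-sum : ∀ s t → nbr-sum s ≡ nbr-sum t → s ≡ t
      distinct-sum (inj₁ i) (inj₁ i') e = cong inj₁ (distinct NG (cong proj₁ e))
      distinct-sum (inj₂ j) (inj₂ j') e = cong inj₂ (distinct NH (cong proj₂ e))
      distinct-sum (inj₁ i) (inj₂ j) e = ⊥-elim (irreflˡ (subst (Adj G g) (cong proj₁ e) (adjacent NG i)))
      distinct-sum (inj₂ j) (inj₁ i) e = ⊥-elim (irreflˡ (subst (Adj G g) (sym (cong proj₁ e)) (adjacent NG i)))
      splitAt-injective : ∀ {i j} → splitAt a i ≡ splitAt a j → i ≡ j
      splitAt-injective {i} {j} e = trans (sym (join-splitAt a b i)) (trans (cong (join a b) e) (join-splitAt a b j))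

module _ {p : ℕ} where

  ascendᵂ : ∀ t (i j : Fin p) → toℕ i + t ≡ toℕ j → Walk (Path p) i j t
  ascendᵂ zero i j i+0≡j =
    subst (λ j' → Walk (Path p) i j' 0) (toℕ-injective (trans (sym (+-identityʳ (toℕ i))) i+0≡j)) here
  ascendᵂ (suc t) i j i+[1+t]≡j = step (inj₁ (sym (toℕ-fromℕ< i+1<p))) (ascendᵂ t _ j i'+t≡j)
    where
      i+1+t≡j : suc (toℕ i + t) ≡ toℕ j
      i+1+t≡j = trans (sym (+-suc (toℕ i) t)) i+[1+t]≡j
      i+1<p : suc (toℕ i) < p
      i+1<p = ≤-<-trans (s≤s (m≤m+n (toℕ i) t)) (subst (_< p) (sym i+1+t≡j) (toℕ<n j))
      i'+t≡j : toℕ (fromℕ< i+1<p) + t ≡ toℕ j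
      i'+t≡j = trans (cong (_+ t) (toℕ-fromℕ< i+1<p)) i+1+t≡j

  pathᵂ : ∀ (i j : Fin p) → Walk (Path p) i j ∣ toℕ i - toℕ j ∣
  pathᵂ i j with ≤-total (toℕ i) (toℕ j)
  ... | inj₁ i≤j = subst (Walk (Path p) i j) (sym (m≤n⇒∣m-n∣≡n∸m i≤j))
                     (ascendᵂ _ i j (m+[n∸m]≡n i≤j))
  ... | inj₂ j≤i = subst (Walk (Path p) i j) (trans (sym (m≤n⇒∣m-n∣≡n∸m j≤i)) (∣-∣-comm (toℕ j) (toℕ i)))
                     (reverseᵂ swap (ascendᵂ _ j i (m+[n∸m]≡n j≤i)))

module _ where
  open BipartiteDistance

  pathDistance : ∀ p → BipartiteDistance (Path p)
  dist (pathDistance p) i j = ∣ toℕ i - toℕ j ∣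
  dist-self (pathDistance p) i = ∣n-n∣≡0 (toℕ i)
  dist-edge (pathDistance p) {i} {j} (inj₁ e) q =
    subst (λ t → OneApart ∣ toℕ i - toℕ q ∣ ∣ t - toℕ q ∣) e (∣-∣-step (toℕ i) (toℕ q))
  dist-edge (pathDistance p) {i} {j} (inj₂ e) q =
    subst (λ t → OneApart ∣ t - toℕ q ∣ ∣ toℕ j - toℕ q ∣) e (OneApart-sym (∣-∣-step (toℕ j) (toℕ q)))
  geodesic (pathDistance p) = pathᵂ

module _ {L : ℕ} where

  endpoint : Bool → Fin (suc L)
  endpoint false = fzero
  endpoint true = fromℕ L

  step-up : ∀ (y : Fin (suc L)) → toℕ y < L → Σ (Fin (suc L)) λ y' → suc (toℕ y) ≡ toℕ y'
  step-up y y<L = fromℕ< (s≤s y<L) , sym (toℕ-fromℕ< (s≤s y<L))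

  step-down : ∀ (y : Fin (suc L)) → toℕ y ≢ 0 → Σ (Fin (suc L)) λ y' → suc (toℕ y') ≡ toℕ y
  step-down y y≢0 = fromℕ< (≤-<-trans pred[n]≤n (toℕ<n y)) ,
    trans (cong suc (toℕ-fromℕ< _)) (suc-pred (toℕ y) {{≢-nonZero y≢0}})

  endpoint-or-interior : (y : Fin (suc L)) → (Σ Bool λ s → y ≡ endpoint s) ⊎ Neighbourhood (Path (suc L)) y 2
  endpoint-or-interior y with toℕ y ≟ 0 | toℕ y ≟ L
  ... | yes y≡0 | _ = inj₁ (false , toℕ-injective y≡0)
  ... | no _ | yes y≡L = inj₁ (true , toℕ-injective (trans y≡L (sym (toℕ-fromℕ L))))
  ... | no y≢0 | no y≢L =
    inj₂ (Neighbourhood-pair (inj₁ up) (inj₂ down) (λ e → 2+n≢n (trans (cong suc (trans up (cong toℕ e))) down)))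
    where
      up = proj₂ (step-up y (≤∧≢⇒< (s≤s⁻¹ (toℕ<n y)) y≢L))
      down = proj₂ (step-down y y≢0)

  some-neighbour : 1 ≤ L → (y : Fin (suc L)) → Neighbourhood (Path (suc L)) y 1
  some-neighbour 1≤L y with toℕ y <? L
  ... | yes y<L = Neighbourhood-single (inj₁ (proj₂ (step-up y y<L)))
  ... | no y≮L = Neighbourhood-single (inj₂ (proj₂ (step-down y y≢0)))
    where
      y≢0 : toℕ y ≢ 0
      y≢0 y≡0 = y≮L (subst (_< L) (sym y≡0) 1≤L)

module EvenCycle (N h : ℕ) (n≡h+h : suc N ≡ h + h) where

  n : ℕ
  n = suc N

  shorterWay : ℕ → ℕ
  shorterWay x = x ⊓ (n ∸ x)

  shorterWay-≤h : ∀ {x} → x ≤ h → shorterWay x ≡ x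
  shorterWay-≤h {x} x≤h = m≤n⇒m⊓n≡m (begin
    x          ≤⟨ x≤h ⟩
    h          ≡⟨ m+n∸m≡n h h ⟨
    h + h ∸ h  ≤⟨ ∸-monoʳ-≤ (h + h) x≤h ⟩
    h + h ∸ x  ≡⟨ cong (_∸ x) n≡h+h ⟨
    n ∸ x      ∎)
    where open ≤-Reasoning

  shorterWay-≥h : ∀ {x} → h ≤ x → shorterWay x ≡ n ∸ x
  shorterWay-≥h {x} h≤x = m≥n⇒m⊓n≡n (begin
    n ∸ x      ≡⟨ cong (_∸ x) n≡h+h ⟩
    h + h ∸ x  ≤⟨ ∸-monoʳ-≤ (h + h) h≤x ⟩
    h + h ∸ h  ≡⟨ m+n∸m≡n h h ⟩
    h          ≤⟨ h≤x ⟩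
    x          ∎)
    where open ≤-Reasoning

  shorterWay-step : ∀ {x} → x < n → OneApart (shorterWay x) (shorterWay (suc x))
  shorterWay-step {x} x<n with x <? h
  ... | yes x<h = inj₁ (trans (cong suc (shorterWay-≤h (<⇒≤ x<h))) (sym (shorterWay-≤h x<h)))
  ... | no x≮h = inj₂ (begin
    suc (shorterWay (suc x))  ≡⟨ cong suc (shorterWay-≥h (m≤n⇒m≤1+n h≤x)) ⟩
    suc (n ∸ suc x)           ≡⟨ +-∸-assoc 1 x<n ⟨
    n ∸ x                     ≡⟨ shorterWay-≥h h≤x ⟨
    shorterWay x              ∎)
    where
      open ≡-Reasoning
      h≤x = ≮⇒≥ x≮h

  shorterWay-mirror : ∀ {x} → x ≤ n → shorterWay (n ∸ x) ≡ shorterWay x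
  shorterWay-mirror {x} x≤n = trans (cong ((n ∸ x) ⊓_) (m∸[m∸n]≡n x≤n)) (⊓-comm (n ∸ x) x)

  cycleDist : ℕ → ℕ → ℕ
  cycleDist a b = shorterWay ∣ a - b ∣

  shorterWay-apart : ∀ {x y} → OneApart x y → x < n → y < n → OneApart (shorterWay x) (shorterWay y)
  shorterWay-apart (inj₁ refl) x<n _ = shorterWay-step x<n
  shorterWay-apart (inj₂ refl) _ y<n = OneApart-sym (shorterWay-step y<n)

  cycleDist-sym : ∀ a b → cycleDist a b ≡ cycleDist b a
  cycleDist-sym a b = cong shorterWay (∣-∣-comm a b)

  cycleDist-suc : ∀ {a z} → suc a < n → z < n → OneApart (cycleDist a z) (cycleDist (suc a) z)
  cycleDist-suc {a} {z} a+1<n z<n = shorterWay-apart (∣-∣-step a z)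
    (≤-<-trans (∣m-n∣≤m⊔n a z) (⊔-lub (<⇒≤ a+1<n) z<n))
    (≤-<-trans (∣m-n∣≤m⊔n (suc a) z) (⊔-lub a+1<n z<n))

  cycleDist-wrap : ∀ {z} → z < n → OneApart (cycleDist N z) (cycleDist 0 z)
  cycleDist-wrap {z} z<n = subst (λ t → OneApart t (shorterWay z)) (sym N-z≡1+z) (OneApart-sym (shorterWay-step z<n))
    where
      N-z≡1+z : cycleDist N z ≡ shorterWay (suc z)
      N-z≡1+z = trans (cong shorterWay (trans (∣-∣-comm N z) (m≤n⇒∣m-n∣≡n∸m (s≤s⁻¹ z<n)))) (shorterWay-mirror z<n)

  cycleDist-edge : ∀ {a b z} → a < n → z < n → suc a % n ≡ b → OneApart (cycleDist a z) (cycleDist b z)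
  cycleDist-edge {a} {b} {z} a<n z<n a+1%n≡b with suc a <? n
  ... | yes a+1<n = subst (λ t → OneApart (cycleDist a z) (cycleDist t z))
                          (trans (sym (m<n⇒m%n≡m a+1<n)) a+1%n≡b) (cycleDist-suc a+1<n z<n)
  ... | no a+1≮n = subst₂ (λ s t → OneApart (cycleDist s z) (cycleDist t z)) (sym a≡N)
                          (trans (sym (n%n≡0 n)) (trans (cong (λ t → suc t % n) (sym a≡N)) a+1%n≡b)) (cycleDist-wrap z<n)
    where
      a≡N : a ≡ N
      a≡N = ≤-antisym (s≤s⁻¹ a<n) (s≤s⁻¹ (≮⇒≥ a+1≮n))

  around-length : ∀ {a b M} → a ≤ b → b ≤ M → a + suc (M ∸ b) ≡ suc M ∸ (b ∸ a)
  around-length {zero} z≤n b≤M = sym (+-∸-assoc 1 b≤M)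
  around-length {suc a} {suc b} {suc M} (s≤s a≤b) (s≤s b≤M) =
    trans (cong suc (around-length a≤b b≤M)) (sym (+-∸-assoc 1 (≤-trans (m∸n≤m b a) (m≤n⇒m≤1+n b≤M))))

  shorterWay-halves : ∀ {t t'} → t ≤ h → h ≤ t' → t' < n → shorterWay t ≡ shorterWay t' →
    shorterWay ∣ t - 1 ∣ ≡ shorterWay ∣ t' - 1 ∣ → t ≡ t'
  shorterWay-halves {zero} {t'} _ h≤t' t'<n 0≡sw[t'] _ =
    ⊥-elim (<⇒≱ t'<n (m∸n≡0⇒m≤n (trans (sym (shorterWay-≥h h≤t')) (sym 0≡sw[t']))))
  shorterWay-halves {suc s} {zero} 1+s≤h h≤0 _ _ _ = ⊥-elim (n≮0 (≤-trans 1+s≤h h≤0))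
  shorterWay-halves {suc s} {suc s'} 1+s≤h h≤1+s' 1+s'<n same-dist same-dist-to-1 with s' <? h
  ... | yes s'<h = trans (sym (shorterWay-≤h 1+s≤h)) (trans same-dist (shorterWay-≤h s'<h))
  ... | no s'≮h = ⊥-elim (2+n≢n (sym (begin
    s                     ≡⟨ shorterWay-≤h (≤-trans (n≤1+n s) 1+s≤h) ⟨
    shorterWay s          ≡⟨ cong shorterWay (∣-∣-identityʳ s) ⟨
    shorterWay ∣ s - 0 ∣  ≡⟨ same-dist-to-1 ⟩
    shorterWay ∣ s' - 0 ∣ ≡⟨ cong shorterWay (∣-∣-identityʳ s') ⟩
    shorterWay s'         ≡⟨ shorterWay-≥h (≮⇒≥ s'≮h) ⟩
    n ∸ s'                ≡⟨ +-∸-assoc 1 (<⇒≤ 1+s'<n) ⟩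
    suc (n ∸ suc s')      ≡⟨ cong suc (shorterWay-≥h h≤1+s') ⟨
    suc (shorterWay (suc s')) ≡⟨ cong suc same-dist ⟨
    suc (shorterWay (suc s))  ≡⟨ cong suc (shorterWay-≤h 1+s≤h) ⟩
    suc (suc s)           ∎)))
    where open ≡-Reasoning

  shorterWay-locates : ∀ {t t'} → t < n → t' < n → shorterWay t ≡ shorterWay t' →
    shorterWay ∣ t - 1 ∣ ≡ shorterWay ∣ t' - 1 ∣ → t ≡ t'
  shorterWay-locates {t} {t'} t<n t'<n same-dist same-dist-to-1 with ≤-total t h | ≤-total t' h
  ... | inj₁ t≤h | inj₁ t'≤h = trans (sym (shorterWay-≤h t≤h)) (trans same-dist (shorterWay-≤h t'≤h))
  ... | inj₂ h≤t | inj₂ h≤t' = ∸-cancelˡ-≡ (<⇒≤ t<n) (<⇒≤ t'<n)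
                                  (trans (sym (shorterWay-≥h h≤t)) (trans same-dist (shorterWay-≥h h≤t')))
  ... | inj₁ t≤h | inj₂ h≤t' = shorterWay-halves t≤h h≤t' t'<n same-dist same-dist-to-1
  ... | inj₂ h≤t | inj₁ t'≤h = sym (shorterWay-halves t'≤h h≤t t<n (sym same-dist) (sym same-dist-to-1))

  cycleDist-0-1-injective : ∀ {t t'} → t < n → t' < n → cycleDist t 0 ≡ cycleDist t' 0 →
    cycleDist t 1 ≡ cycleDist t' 1 → t ≡ t'
  cycleDist-0-1-injective {t} {t'} t<n t'<n same-dist =
    shorterWay-locates t<n t'<n
      (subst₂ (λ a b → shorterWay a ≡ shorterWay b) (∣-∣-identityʳ t) (∣-∣-identityʳ t') same-dist)

  C : Graph
  C = Cycle n

  next prev : Fin n → Fin n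
  next a = fromℕ< (m%n<n (suc (toℕ a)) n)
  prev fzero = fromℕ N
  prev (fsuc a) = inject₁ a

  next-edge : ∀ a → Adj C a (next a)
  next-edge a = inj₁ (sym (toℕ-fromℕ< _))

  suc-prev : ∀ a → suc (toℕ (prev a)) % n ≡ toℕ a
  suc-prev fzero = trans (cong (λ t → suc t % n) (toℕ-fromℕ N)) (n%n≡0 n)
  suc-prev (fsuc a) = trans (cong (λ t → suc t % n) (toℕ-inject₁ a)) (m<n⇒m%n≡m (s≤s (toℕ<n a)))

  prev-edge : ∀ a → Adj C a (prev a)
  prev-edge a = inj₂ (suc-prev a)

  pathEdge⇒cycleEdge : ∀ {i j} → Adj (Path n) i j → Adj C i j
  pathEdge⇒cycleEdge {j = j} (inj₁ e) = inj₁ (trans (m<n⇒m%n≡m (subst (_< n) (sym e) (toℕ<n j))) e)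
  pathEdge⇒cycleEdge {i = i} (inj₂ e) = inj₂ (trans (m<n⇒m%n≡m (subst (_< n) (sym e) (toℕ<n i))) e)

  cycleᵂ-ascending : ∀ (i j : Fin n) → toℕ i ≤ toℕ j → Walk C i j (cycleDist (toℕ i) (toℕ j))
  cycleᵂ-ascending i j i≤j with ⊓-sel ∣ toℕ i - toℕ j ∣ (n ∸ ∣ toℕ i - toℕ j ∣)
  ... | inj₁ short = subst (Walk C i j) (sym short) (mapᵂ pathEdge⇒cycleEdge (pathᵂ i j))
  ... | inj₂ long = subst (Walk C i j) (sym long) (subst (Walk C i j) length≡ around)
    where
      j≤N = s≤s⁻¹ (toℕ<n j)
      around : Walk C i j (∣ toℕ i - 0 ∣ + suc ∣ toℕ (fromℕ N) - toℕ j ∣)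
      around = mapᵂ pathEdge⇒cycleEdge (pathᵂ i fzero)
           ++ᵂ step (prev-edge fzero) (mapᵂ pathEdge⇒cycleEdge (pathᵂ (fromℕ N) j))
      length≡ : ∣ toℕ i - 0 ∣ + suc ∣ toℕ (fromℕ N) - toℕ j ∣ ≡ n ∸ ∣ toℕ i - toℕ j ∣
      length≡ = begin
        ∣ toℕ i - 0 ∣ + suc ∣ toℕ (fromℕ N) - toℕ j ∣
          ≡⟨ cong₂ (λ s t → s + suc ∣ t - toℕ j ∣) (∣-∣-identityʳ (toℕ i)) (toℕ-fromℕ N) ⟩
        toℕ i + suc ∣ N - toℕ j ∣
          ≡⟨ cong (λ t → toℕ i + suc t) (trans (∣-∣-comm N (toℕ j)) (m≤n⇒∣m-n∣≡n∸m j≤N)) ⟩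
        toℕ i + suc (N ∸ toℕ j)
          ≡⟨ around-length i≤j j≤N ⟩
        n ∸ (toℕ j ∸ toℕ i)
          ≡⟨ cong (n ∸_) (m≤n⇒∣m-n∣≡n∸m i≤j) ⟨
        n ∸ ∣ toℕ i - toℕ j ∣ ∎
        where open ≡-Reasoning

  cycleᵂ : ∀ (i j : Fin n) → Walk C i j (cycleDist (toℕ i) (toℕ j))
  cycleᵂ i j with ≤-total (toℕ i) (toℕ j)
  ... | inj₁ i≤j = cycleᵂ-ascending i j i≤j
  ... | inj₂ j≤i = subst (Walk C i j) (cycleDist-sym (toℕ j) (toℕ i)) (reverseᵂ swap (cycleᵂ-ascending j i j≤i))

  two-steps-around : 2 ≤ N → ∀ {a} → a < n → suc (suc a % n) % n ≢ a
  two-steps-around 2≤N {a} a<n with suc a <? n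
  ... | no a+1≮n = λ e → <-irrefl (trans (cong suc (trans (sym lands-on-1) e)) a+1≡n) (s≤s 2≤N)
    where
      a+1≡n = ≤-antisym a<n (≮⇒≥ a+1≮n)
      lands-on-1 : suc (suc a % n) % n ≡ 1
      lands-on-1 = trans (cong (λ t → suc t % n) (trans (cong (_% n) a+1≡n) (n%n≡0 n)))
                         (m<n⇒m%n≡m (s≤s (≤-trans (s≤s z≤n) 2≤N)))
  ... | yes a+1<n rewrite m<n⇒m%n≡m a+1<n with suc (suc a) <? n
  ...   | yes a+2<n rewrite m<n⇒m%n≡m a+2<n = 2+n≢n
  ...   | no a+2≮n = λ e → <-irrefl (trans (cong (λ t → suc (suc t)) (trans (sym lands-on-0) e)) a+2≡n) (s≤s 2≤N)
    where
      a+2≡n = ≤-antisym a+1<n (≮⇒≥ a+2≮n)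
      lands-on-0 : suc (suc a) % n ≡ 0
      lands-on-0 = trans (cong (_% n) a+2≡n) (n%n≡0 n)

  cycleNeighbourhood : 2 ≤ N → ∀ a → Neighbourhood C a 2
  cycleNeighbourhood 2≤N a = Neighbourhood-pair (next-edge a) (prev-edge a) next≢prev
    where
      next≢prev : next a ≢ prev a
      next≢prev e = two-steps-around 2≤N (toℕ<n a) (begin
        suc (suc (toℕ a) % n) % n   ≡⟨ cong (λ t → suc t % n) (toℕ-fromℕ< _) ⟨
        suc (toℕ (next a)) % n      ≡⟨ cong (λ t → suc (toℕ t) % n) e ⟩
        suc (toℕ (prev a)) % n      ≡⟨ suc-prev a ⟩
        toℕ a                       ∎)
        where open ≡-Reasoning

  open BipartiteDistance using (dist; dist-self; dist-edge; geodesic)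

  cycleDistance : BipartiteDistance C
  dist cycleDistance i j = cycleDist (toℕ i) (toℕ j)
  dist-self cycleDistance i = cong shorterWay (∣n-n∣≡0 (toℕ i))
  dist-edge cycleDistance {i} {j} (inj₁ e) q = cycleDist-edge (toℕ<n i) (toℕ<n q) e
  dist-edge cycleDistance {i} {j} (inj₂ e) q = OneApart-sym (cycleDist-edge (toℕ<n j) (toℕ<n q) e)
  geodesic cycleDistance = cycleᵂ

module Resolvability {G : Graph} (d : BipartiteDistance G) where
  open BipartiteDistance d

  Unresolved : V G → V G → V G → Set
  Unresolved q₁ q₂ q₃ = Σ (V G) λ x → Σ (V G) λ x' →
    x ≢ x' × dist x q₁ ≡ dist x' q₁ × dist x q₂ ≡ dist x' q₂ × dist x q₃ ≡ dist x' q₃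

  Unresolved-swap₁₂ : ∀ {q₁ q₂ q₃} → Unresolved q₁ q₂ q₃ → Unresolved q₂ q₁ q₃
  Unresolved-swap₁₂ (x , x' , x≢x' , e₁ , e₂ , e₃) = x , x' , x≢x' , e₂ , e₁ , e₃

  Unresolved-swap₂₃ : ∀ {q₁ q₂ q₃} → Unresolved q₁ q₂ q₃ → Unresolved q₁ q₃ q₂
  Unresolved-swap₂₃ (x , x' , x≢x' , e₁ , e₂ , e₃) = x , x' , x≢x' , e₁ , e₃ , e₂

  Unresolved-rotate : ∀ {q₁ q₂ q₃} → Unresolved q₂ q₃ q₁ → Unresolved q₁ q₂ q₃
  Unresolved-rotate (x , x' , x≢x' , e₂ , e₃ , e₁) = x , x' , x≢x' , e₁ , e₂ , e₃

  adjacent-twins : ∀ {v u w q₁ q₂ q₃} (e : Adj G v u) (e' : Adj G v w) → u ≢ w →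
    slope e q₁ ≡ slope e' q₁ → slope e q₂ ≡ slope e' q₂ → slope e q₃ ≡ slope e' q₃ → Unresolved q₁ q₂ q₃
  adjacent-twins {u = u} {w} e e' u≢w same₁ same₂ same₃ =
    u , w , u≢w , same-dist same₁ , same-dist same₂ , same-dist same₃
    where
      same-dist : ∀ {q} → slope e q ≡ slope e' q → dist u q ≡ dist w q
      same-dist {q} = same-rise⇒≡ (dist-edge e q) (dist-edge e' q)

  two-step-twins : ∀ {v u x u' x' q₁ q₂ q₃}
    (e₁ : Adj G v u) (e₂ : Adj G u x) (f₁ : Adj G v u') (f₂ : Adj G u' x') → x ≢ x' →
    SameSteps (slope e₁ q₁) (slope e₂ q₁) (slope f₁ q₁) (slope f₂ q₁) →
    SameSteps (slope e₁ q₂) (slope e₂ q₂) (slope f₁ q₂) (slope f₂ q₂) →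
    SameSteps (slope e₁ q₃) (slope e₂ q₃) (slope f₁ q₃) (slope f₂ q₃) → Unresolved q₁ q₂ q₃
  two-step-twins {x = x} {x' = x'} e₁ e₂ f₁ f₂ x≢x' same₁ same₂ same₃ =
    x , x' , x≢x' , same-dist same₁ , same-dist same₂ , same-dist same₃
    where
      same-dist : ∀ {q} → SameSteps (slope e₁ q) (slope e₂ q) (slope f₁ q) (slope f₂ q) → dist x q ≡ dist x' q
      same-dist {q} = two-steps⇒≡ (dist-edge e₁ q) (dist-edge e₂ q) (dist-edge f₁ q) (dist-edge f₂ q)

  unresolved⇒¬resolving : ∀ {q₁ q₂ q₃ Q} → Unresolved q₁ q₂ q₃ →
    (∀ {q} → q ∈ Q → q ∈ q₁ ∷ q₂ ∷ q₃ ∷ []) → ¬ Resolving G Q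
  unresolved⇒¬resolving (x , x' , x≢x' , e₁ , e₂ , e₃) Q⊆ resolves = x≢x' (resolves x x' same-distances)
    where
      same-dist : ∀ {q} → q ∈ _ ∷ _ ∷ _ ∷ [] → dist x q ≡ dist x' q
      same-dist (here refl) = e₁
      same-dist (there (here refl)) = e₂
      same-dist (there (there (here refl))) = e₃
      same-distances : ∀ q → q ∈ _ → ∀ a b → Dist G x q a → Dist G x' q b → a ≡ b
      same-distances q q∈Q a b dxq dx'q =
        trans (Dist⇒≡dist dxq) (trans (same-dist (Q⊆ q∈Q)) (sym (Dist⇒≡dist dx'q)))

  all-triples-unresolved⇒4≤length : V G → (∀ q₁ q₂ q₃ → Unresolved q₁ q₂ q₃) →
    ∀ Q → Resolving G Q → 4 ≤ length Q
  all-triples-unresolved⇒4≤length v unresolved [] = ⊥-elim ∘ unresolved⇒¬resolving (unresolved v v v) λ ()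
  all-triples-unresolved⇒4≤length v unresolved (q₁ ∷ []) =
    ⊥-elim ∘ unresolved⇒¬resolving (unresolved q₁ q₁ q₁) λ { (here e) → here e }
  all-triples-unresolved⇒4≤length v unresolved (q₁ ∷ q₂ ∷ []) =
    ⊥-elim ∘ unresolved⇒¬resolving (unresolved q₁ q₂ q₂) λ { (here e) → here e ; (there (here e)) → there (here e) }
  all-triples-unresolved⇒4≤length v unresolved (q₁ ∷ q₂ ∷ q₃ ∷ []) =
    ⊥-elim ∘ unresolved⇒¬resolving (unresolved q₁ q₂ q₃) id
  all-triples-unresolved⇒4≤length v unresolved (_ ∷ _ ∷ _ ∷ _ ∷ _) _ = s≤s (s≤s (s≤s (s≤s z≤n)))

module Pigeonhole {G : Graph} (d : BipartiteDistance G) where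
  open BipartiteDistance d
  open Resolvability d
  open Neighbourhood

  bit : Bool → Fin 2
  bit false = fzero
  bit true = fsuc fzero

  bit-injective : ∀ {b b'} → bit b ≡ bit b' → b ≡ b'
  bit-injective {false} {false} _ = refl
  bit-injective {true} {true} _ = refl

  -- Each neighbour of v is at distance 1 from v; its slopes towards p and r take
  -- only four values, so two of five neighbours cannot be told apart by v, p, r.
  five-neighbours-unresolved : ∀ {v} → Neighbourhood G v 5 → ∀ p r → Unresolved v p r
  five-neighbours-unresolved {v} Nv p r with pigeonhole (s≤s (s≤s (s≤s (s≤s (s≤s z≤n))))) profile
    where
      profile : Fin 5 → Fin 4
      profile i = combine (bit (slope (adjacent Nv i) p)) (bit (slope (adjacent Nv i) r))
  ... | i , j , i<j , same-profile =
    adjacent-twins (adjacent Nv i) (adjacent Nv j) (<⇒≢ᶠ i<j ∘ distinct Nv)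
      (trans (rises-from-v i) (sym (rises-from-v j))) slope-p slope-r
    where
      rises-from-v : ∀ k → slope (adjacent Nv k) v ≡ true
      rises-from-v k = slope-from-self (adjacent Nv k)
      σ : Fin 5 → V G → Fin 2
      σ k q = bit (slope (adjacent Nv k) q)
      same-bits = combine-injective (σ i p) (σ i r) (σ j p) (σ j r) same-profile
      slope-p = bit-injective (proj₁ same-bits)
      slope-r = bit-injective (proj₂ same-bits)

module Prism (N K M h : ℕ) (n≡h+h : suc N ≡ h + h) where
  open EvenCycle N h n≡h+h public

  k m : ℕ
  k = suc K
  m = suc M

  Vertex : Set
  Vertex = (Fin n × Fin k) × Fin m

  G : Graph
  G = (C □ Path k) □ Path m

  prismDistance : BipartiteDistance G
  prismDistance = (cycleDistance ⊠ pathDistance k) ⊠ pathDistance m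

  open BipartiteDistance prismDistance

  module ResolvingSet (1≤N : 1 ≤ N) where

    one : Fin n
    one = fromℕ< (s≤s 1≤N)

    landmarks : List Vertex
    landmarks = ((fzero , fzero) , fzero) ∷ ((fzero , fzero) , fromℕ M) ∷ ((fzero , fromℕ K) , fzero)
              ∷ ((one , fzero) , fzero) ∷ []

    base-dist : ∀ a i y z → dist ((i , y) , z) ((a , fzero) , fzero) ≡ (cycleDist (toℕ i) (toℕ a) + toℕ y) + toℕ z
    base-dist a i y z =
      cong₂ (λ s t → (cycleDist (toℕ i) (toℕ a) + s) + t) (∣-∣-identityʳ (toℕ y)) (∣-∣-identityʳ (toℕ z))

    top-z-dist : ∀ i y z → dist ((i , y) , z) ((fzero , fzero) , fromℕ M) ≡ (cycleDist (toℕ i) 0 + toℕ y) + (M ∸ toℕ z)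
    top-z-dist i y z = cong₂ (λ s t → (cycleDist (toℕ i) 0 + s) + t) (∣-∣-identityʳ (toℕ y)) (∣-∣-to-last z)

    top-y-dist : ∀ i y z → dist ((i , y) , z) ((fzero , fromℕ K) , fzero) ≡ (cycleDist (toℕ i) 0 + (K ∸ toℕ y)) + toℕ z
    top-y-dist i y z = cong₂ (λ s t → (cycleDist (toℕ i) 0 + s) + t) (∣-∣-to-last y) (∣-∣-identityʳ (toℕ z))

    -- The first three landmarks read off z, then y, then the distance of i to 0; the last one its distance to 1.
    landmarks-resolve : Resolving G landmarks
    landmarks-resolve ((i , y) , z) ((i' , y') , z') resolves =
      cong₂ _,_ (cong₂ _,_ (toℕ-injective i≡i') (toℕ-injective y≡y')) (toℕ-injective z≡z')
      where
        same : ∀ {q a a'} → q ∈ landmarks → dist ((i , y) , z) q ≡ a → dist ((i' , y') , z') q ≡ a' → a ≡ a'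
        same {q} q∈ ≡a ≡a' = trans (sym ≡a) (trans (resolves q q∈ _ _ (isDist _ q) (isDist _ q)) ≡a')
        at-origin = same (here refl) (base-dist fzero i y z) (base-dist fzero i' y' z')
        at-top-z = same (there (here refl)) (top-z-dist i y z) (top-z-dist i' y' z')
        at-top-y = same (there (there (here refl))) (top-y-dist i y z) (top-y-dist i' y' z')
        at-one = same (there (there (there (here refl)))) (base-dist one i y z) (base-dist one i' y' z')
        z≡z' : toℕ z ≡ toℕ z'
        z≡z' = reflected-sums⇒≡ M at-origin at-top-z
        cancel-z : ∀ {a a'} → a + toℕ z ≡ a' + toℕ z' → a ≡ a'
        cancel-z e = +-cancelʳ-≡ (toℕ z) _ _ (trans e (cong (_ +_) (sym z≡z')))
        y≡y' : toℕ y ≡ toℕ y'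
        y≡y' = reflected-sums⇒≡ K (cancel-z at-origin) (cancel-z at-top-y)
        cancel-y : ∀ {a a'} → a + toℕ y ≡ a' + toℕ y' → a ≡ a'
        cancel-y e = +-cancelʳ-≡ (toℕ y) _ _ (trans e (cong (_ +_) (sym y≡y')))
        i≡i' : toℕ i ≡ toℕ i'
        i≡i' = cycleDist-0-1-injective (toℕ<n i) (toℕ<n i') (cancel-y (cancel-z at-origin))
                 (subst (λ o → cycleDist (toℕ i) o ≡ cycleDist (toℕ i') o) (toℕ-fromℕ< (s≤s 1≤N))
                   (cancel-y (cancel-z at-one)))

module NoResolvingTriple (N' K' M' h : ℕ) (n≡h+h : 4 + N' ≡ h + h) where
  open Prism (3 + N') (2 + K') (1 + M') h n≡h+h
  open BipartiteDistance using (adj-irrefl; adj⇒≢; slope; slope-rises; slope-falls; slope-from-self)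
  open Resolvability prismDistance
  open Pigeonhole prismDistance using (five-neighbours-unresolved)
  open Neighbourhood

  -- The landmark over a corner of the k × m rectangle; false/true select the first/last index.
  -- Corners on the same diagonal of the rectangle have the same  s xor t.
  corner : Fin n → Bool → Bool → Vertex
  corner a s t = (a , endpoint s) , endpoint t

  prism-neighbourhood : ∀ {a y z b c} → Neighbourhood (Path k) y b → Neighbourhood (Path m) z c →
    Neighbourhood G ((a , y) , z) ((2 + b) + c)
  prism-neighbourhood {a} Ny Nz =
    Neighbourhood-□ (adj-irrefl (cycleDistance ⊠ pathDistance k))
      (Neighbourhood-□ (adj-irrefl cycleDistance) (cycleNeighbourhood (s≤s (s≤s z≤n)) a) Ny) Nz

  corner-or-five-neighbours : ∀ q → (Σ (Fin n) λ a → Σ Bool λ s → Σ Bool λ t → q ≡ corner a s t) ⊎ Neighbourhood G q 5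
  corner-or-five-neighbours ((a , y) , z) with endpoint-or-interior y | endpoint-or-interior z
  ... | inj₂ Ny | _ = inj₂ (prism-neighbourhood Ny (some-neighbour (s≤s z≤n) z))
  ... | inj₁ _ | inj₂ Nz = inj₂ (prism-neighbourhood (some-neighbour (s≤s z≤n) y) Nz)
  ... | inj₁ (s , refl) | inj₁ (t , refl) = inj₁ (a , s , t , refl)

  y₁ : Fin k
  y₁ = fsuc fzero

  away : Bool → Fin k
  away false = fsuc (fsuc fzero)
  away true = fzero

  away-edge : ∀ s₁ → Adj (Path k) y₁ (away s₁)
  away-edge false = inj₁ refl
  away-edge true = inj₂ refl

  slope-away : ∀ s₁ s → slope (pathDistance k) (away-edge s₁) (endpoint s) ≡ not (s xor s₁)
  slope-away false false = slope-rises (pathDistance k) (away-edge false) (endpoint false) refl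
  slope-away false true = slope-falls (pathDistance k) (away-edge false) (endpoint true) refl
  slope-away true false = slope-falls (pathDistance k) (away-edge true) (endpoint false) refl
  slope-away true true = slope-rises (pathDistance k) (away-edge true) (endpoint true) refl

  inward : Bool → Fin m
  inward false = fsuc fzero
  inward true = inject₁ (fromℕ M')

  inward-edge : ∀ t₁ → Adj (Path m) (endpoint t₁) (inward t₁)
  inward-edge false = inj₁ refl
  inward-edge true = inj₂ (cong suc (toℕ-inject₁ (fromℕ M')))

  slope-inward : ∀ t₁ t → slope (pathDistance m) (inward-edge t₁) (endpoint t) ≡ not (t xor t₁)
  slope-inward false false = slope-rises (pathDistance m) (inward-edge false) (endpoint false) refl
  slope-inward false true = slope-falls (pathDistance m) (inward-edge false) (endpoint true) refl
  slope-inward true false = slope-falls (pathDistance m) (inward-edge true) (endpoint false)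
    (cong suc (trans (cong ∣_- 0 ∣ (toℕ-inject₁ (fromℕ M'))) (∣-∣-identityʳ _)))
  slope-inward true true = slope-rises (pathDistance m) (inward-edge true) (endpoint true) (begin
    suc ∣ x - x ∣                          ≡⟨ cong suc (∣n-n∣≡0 x) ⟩
    1                                      ≡⟨ ∣m-m+n∣≡n x 1 ⟨
    ∣ x - x + 1 ∣                          ≡⟨ cong ∣ x -_∣ (+-comm x 1) ⟩
    ∣ x - suc x ∣                          ≡⟨ cong ∣_- suc x ∣ (toℕ-inject₁ (fromℕ M')) ⟨
    ∣ toℕ (inject₁ (fromℕ M')) - suc x ∣   ∎)
    where
      open ≡-Reasoning
      x = toℕ (fromℕ M')

  -- From the centre, the two cycle neighbours w i and the steps along y and z away from
  -- q₁ all move away from q₁. Their slopes σ are computed in the factors; those along y and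
  -- z agree at a corner exactly when it lies on a diagonal parallel to that of q₁.
  module Centre (a₁ : Fin n) (s₁ t₁ : Bool) where

    q₁ : Vertex
    q₁ = corner a₁ s₁ t₁

    centre : Vertex
    centre = (a₁ , y₁) , endpoint t₁

    Nc : Neighbourhood C a₁ 2
    Nc = cycleNeighbourhood (s≤s (s≤s z≤n)) a₁

    w : Fin 2 → Vertex
    w i = (nbr Nc i , y₁) , endpoint t₁

    w-edge : ∀ i → Adj G centre (w i)
    w-edge i = inj₁ (refl , inj₁ (refl , adjacent Nc i))

    y-edge : ∀ a → Adj G ((a , y₁) , endpoint t₁) ((a , away s₁) , endpoint t₁)
    y-edge a = inj₁ (refl , inj₂ (refl , away-edge s₁))

    z-edge : ∀ a → Adj G ((a , y₁) , endpoint t₁) ((a , y₁) , inward t₁)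
    z-edge a = inj₂ (refl , inward-edge t₁)

    σw : Fin 2 → Vertex → Bool
    σw i q = slope cycleDistance (adjacent Nc i) (proj₁ (proj₁ q))

    σy σz : Vertex → Bool
    σy q = slope (pathDistance k) (away-edge s₁) (proj₂ (proj₁ q))
    σz q = slope (pathDistance m) (inward-edge t₁) (proj₂ q)

    slope-w : ∀ i q → slope prismDistance (w-edge i) q ≡ σw i q
    slope-w i q = trans
      (slope-⊠ˡ (cycleDistance ⊠ pathDistance k) (pathDistance m) {a₁ , y₁} {nbr Nc i , y₁}
        (inj₁ (refl , adjacent Nc i)) (endpoint t₁) q)
      (slope-⊠ˡ cycleDistance (pathDistance k) (adjacent Nc i) y₁ (proj₁ q))

    slope-y : ∀ a q → slope prismDistance (y-edge a) q ≡ σy q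
    slope-y a q = trans
      (slope-⊠ˡ (cycleDistance ⊠ pathDistance k) (pathDistance m) {a , y₁} {a , away s₁}
        (inj₂ (refl , away-edge s₁)) (endpoint t₁) q)
      (slope-⊠ʳ cycleDistance (pathDistance k) (away-edge s₁) a (proj₁ q))

    slope-z : ∀ a q → slope prismDistance (z-edge a) q ≡ σz q
    slope-z a q = slope-⊠ʳ (cycleDistance ⊠ pathDistance k) (pathDistance m) (inward-edge t₁) (a , y₁) q

    matching : ∀ {a b c d : Bool} → a ≡ c → b ≡ d → c ≡ d → a ≡ b
    matching a≡c b≡d c≡d = trans a≡c (trans c≡d (sym b≡d))

    parallel-diagonal : ∀ b s t → s xor t ≡ s₁ xor t₁ → σy (corner b s t) ≡ σz (corner b s t)
    parallel-diagonal b s t d = matching (slope-away s₁ s) (slope-inward t₁ t) (cong not (xor-exchange s t s₁ t₁ d))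

    crossing-diagonal : ∀ b s t → s xor t ≢ s₁ xor t₁ → σy (corner b s t) ≢ σz (corner b s t)
    crossing-diagonal b s t d e =
      d (xor-exchange s s₁ t t₁ (not-injective (matching (sym (slope-away s₁ s)) (sym (slope-inward t₁ t)) e)))

    y₁≢away : y₁ ≢ away s₁
    y₁≢away = adj⇒≢ (pathDistance k) (away-edge s₁)

    endpoint≢inward : endpoint t₁ ≢ inward t₁
    endpoint≢inward = adj⇒≢ (pathDistance m) (inward-edge t₁)

    different-y : ∀ {a a' : Fin n} {y y' : Fin k} {z z' : Fin m} → y ≢ y' → ((a , y) , z) ≢ ((a' , y') , z')
    different-y y≢y' = y≢y' ∘ cong (proj₂ ∘ proj₁)

    different-z : ∀ {a a' : Fin n} {y y' : Fin k} {z z' : Fin m} → z ≢ z' → ((a , y) , z) ≢ ((a' , y') , z')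
    different-z z≢z' = z≢z' ∘ cong proj₂

    w-distinct : w fzero ≢ w (fsuc fzero)
    w-distinct e with distinct Nc (cong (proj₁ ∘ proj₁) e)
    ... | ()

    σw-q₁ : ∀ i → σw i q₁ ≡ true
    σw-q₁ i = slope-from-self cycleDistance (adjacent Nc i)

    σy-q₁ : σy q₁ ≡ true
    σy-q₁ = trans (slope-away s₁ s₁) (cong not (xor-same s₁))

    σz-q₁ : σz q₁ ≡ true
    σz-q₁ = trans (slope-inward t₁ t₁) (cong not (xor-same t₁))

    yz-twins : ∀ {q₂ q₃} → σy q₂ ≡ σz q₂ → σy q₃ ≡ σz q₃ → Unresolved q₁ q₂ q₃
    yz-twins {q₂} {q₃} yz₂ yz₃ =
      adjacent-twins (y-edge a₁) (z-edge a₁) (different-y (y₁≢away ∘ sym))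
        (matching (slope-y a₁ q₁) (slope-z a₁ q₁) (trans σy-q₁ (sym σz-q₁)))
        (matching (slope-y a₁ q₂) (slope-z a₁ q₂) yz₂)
        (matching (slope-y a₁ q₃) (slope-z a₁ q₃) yz₃)

    w-twins : ∀ {q₂ q₃} → σw fzero q₂ ≡ σw (fsuc fzero) q₂ → σw fzero q₃ ≡ σw (fsuc fzero) q₃ →
      Unresolved q₁ q₂ q₃
    w-twins {q₂} {q₃} ww₂ ww₃ =
      adjacent-twins (w-edge fzero) (w-edge (fsuc fzero)) w-distinct
        (matching (slope-w fzero q₁) (slope-w (fsuc fzero) q₁) (trans (σw-q₁ fzero) (sym (σw-q₁ (fsuc fzero)))))
        (matching (slope-w fzero q₂) (slope-w (fsuc fzero) q₂) ww₂)
        (matching (slope-w fzero q₃) (slope-w (fsuc fzero) q₃) ww₃)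

    wy-twins : ∀ i {q₂ q₃} → σw i q₂ ≡ σy q₂ → σw i q₃ ≡ σy q₃ → Unresolved q₁ q₂ q₃
    wy-twins i {q₂} {q₃} wy₂ wy₃ =
      adjacent-twins (w-edge i) (y-edge a₁) (different-y y₁≢away)
        (matching (slope-w i q₁) (slope-y a₁ q₁) (trans (σw-q₁ i) (sym σy-q₁)))
        (matching (slope-w i q₂) (slope-y a₁ q₂) wy₂)
        (matching (slope-w i q₃) (slope-y a₁ q₃) wy₃)

    wz-twins : ∀ i {q₂ q₃} → σw i q₂ ≡ σz q₂ → σw i q₃ ≡ σz q₃ → Unresolved q₁ q₂ q₃
    wz-twins i {q₂} {q₃} wz₂ wz₃ =
      adjacent-twins (w-edge i) (z-edge a₁) (different-z endpoint≢inward)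
        (matching (slope-w i q₁) (slope-z a₁ q₁) (trans (σw-q₁ i) (sym σz-q₁)))
        (matching (slope-w i q₂) (slope-z a₁ q₂) wz₂)
        (matching (slope-w i q₃) (slope-z a₁ q₃) wz₃)

    wy-wz-twins : ∀ i j {q₂ q₃} → σw i q₂ ≡ σw j q₂ → σy q₂ ≡ σz q₂ → σw i q₃ ≡ σz q₃ → σy q₃ ≡ σw j q₃ →
      Unresolved q₁ q₂ q₃
    wy-wz-twins i j {q₂} {q₃} ww₂ yz₂ wz₃ yw₃ =
      two-step-twins (w-edge i) (y-edge (nbr Nc i)) (w-edge j) (z-edge (nbr Nc j)) (different-y (y₁≢away ∘ sym))
        (inj₁ (matching (slope-w i q₁) (slope-w j q₁) (trans (σw-q₁ i) (sym (σw-q₁ j))) ,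
               matching (slope-y (nbr Nc i) q₁) (slope-z (nbr Nc j) q₁) (trans σy-q₁ (sym σz-q₁))))
        (inj₁ (matching (slope-w i q₂) (slope-w j q₂) ww₂ , matching (slope-y (nbr Nc i) q₂) (slope-z (nbr Nc j) q₂) yz₂))
        (inj₂ (matching (slope-w i q₃) (slope-z (nbr Nc j) q₃) wz₃ , matching (slope-y (nbr Nc i) q₃) (slope-w j q₃) yw₃))

    w-yz-twins : ∀ i {q₂ q₃} → σy q₂ ≡ σz q₂ → σy q₃ ≢ σz q₃ → σw i q₂ ≡ σy q₂ → Unresolved q₁ q₂ q₃
    w-yz-twins i {q₂} {q₃} yz₂ y≢z₃ wy₂ with σw i q₃ ≟ᵇ σy q₃
    ... | yes wy₃ = wy-twins i wy₂ wy₃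
    ... | no w≢y₃ = wz-twins i (trans wy₂ yz₂) (≢-≢⇒≡ w≢y₃ (y≢z₃ ∘ sym))

    -- In the last case no two neighbours of the centre are twins.
    mixed-twins : ∀ {q₂ q₃} → σy q₂ ≡ σz q₂ → σy q₃ ≢ σz q₃ → Unresolved q₁ q₂ q₃
    mixed-twins {q₂} {q₃} yz₂ y≢z₃ with σw fzero q₂ ≟ᵇ σy q₂ | σw (fsuc fzero) q₂ ≟ᵇ σy q₂
    ... | yes wy₂ | _ = w-yz-twins fzero yz₂ y≢z₃ wy₂
    ... | no _ | yes w'y₂ = w-yz-twins (fsuc fzero) yz₂ y≢z₃ w'y₂
    ... | no w≢y₂ | no w'≢y₂ with σw fzero q₃ ≟ᵇ σw (fsuc fzero) q₃
    ...   | yes ww'₃ = w-twins (≢-≢⇒≡ w≢y₂ w'≢y₂) ww'₃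
    ...   | no w≢w'₃ with σw fzero q₃ ≟ᵇ σz q₃
    ...     | yes wz₃ = wy-wz-twins fzero (fsuc fzero) (≢-≢⇒≡ w≢y₂ w'≢y₂) yz₂ wz₃
                          (≢-≢⇒≡ y≢z₃ (λ w'z₃ → w≢w'₃ (trans wz₃ (sym w'z₃))))
    ...     | no w≢z₃ = wy-wz-twins (fsuc fzero) fzero (≢-≢⇒≡ w'≢y₂ w≢y₂) yz₂
                          (≢-≢⇒≡ (w≢w'₃ ∘ sym) (w≢z₃ ∘ sym)) (≢-≢⇒≡ y≢z₃ w≢z₃)

    corner-triple : ∀ a₂ s₂ t₂ a₃ s₃ t₃ → s₂ xor t₂ ≡ s₁ xor t₁ →
      Unresolved q₁ (corner a₂ s₂ t₂) (corner a₃ s₃ t₃)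
    corner-triple a₂ s₂ t₂ a₃ s₃ t₃ d₂ with s₃ xor t₃ ≟ᵇ s₁ xor t₁
    ... | yes d₃ = yz-twins (parallel-diagonal a₂ s₂ t₂ d₂) (parallel-diagonal a₃ s₃ t₃ d₃)
    ... | no d₃ = mixed-twins (parallel-diagonal a₂ s₂ t₂ d₂) (crossing-diagonal a₃ s₃ t₃ d₃)

  corners-unresolved : ∀ a₁ s₁ t₁ a₂ s₂ t₂ a₃ s₃ t₃ →
    Unresolved (corner a₁ s₁ t₁) (corner a₂ s₂ t₂) (corner a₃ s₃ t₃)
  corners-unresolved a₁ s₁ t₁ a₂ s₂ t₂ a₃ s₃ t₃ with s₂ xor t₂ ≟ᵇ s₁ xor t₁ | s₃ xor t₃ ≟ᵇ s₁ xor t₁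
  ... | yes d₂ | _ = Centre.corner-triple a₁ s₁ t₁ a₂ s₂ t₂ a₃ s₃ t₃ d₂
  ... | no _ | yes d₃ = Unresolved-swap₂₃ (Centre.corner-triple a₁ s₁ t₁ a₃ s₃ t₃ a₂ s₂ t₂ d₃)
  ... | no d₂ | no d₃ = Unresolved-rotate (Centre.corner-triple a₂ s₂ t₂ a₃ s₃ t₃ a₁ s₁ t₁ (≢-≢⇒≡ d₃ d₂))

  every-triple-unresolved : ∀ q₁ q₂ q₃ → Unresolved q₁ q₂ q₃
  every-triple-unresolved q₁ q₂ q₃
    with corner-or-five-neighbours q₁ | corner-or-five-neighbours q₂ | corner-or-five-neighbours q₃
  ... | inj₂ N₁ | _ | _ = five-neighbours-unresolved N₁ q₂ q₃
  ... | inj₁ _ | inj₂ N₂ | _ = Unresolved-swap₁₂ (five-neighbours-unresolved N₂ q₁ q₃)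
  ... | inj₁ _ | inj₁ _ | inj₂ N₃ = Unresolved-rotate (Unresolved-rotate (five-neighbours-unresolved N₃ q₁ q₂))
  ... | inj₁ (a₁ , s₁ , t₁ , refl) | inj₁ (a₂ , s₂ , t₂ , refl) | inj₁ (a₃ , s₃ , t₃ , refl) =
    corners-unresolved a₁ s₁ t₁ a₂ s₂ t₂ a₃ s₃ t₃

  resolving⇒4≤length : ∀ Q → Resolving G Q → 4 ≤ length Q
  resolving⇒4≤length = all-triples-unresolved⇒4≤length (corner fzero false false) every-triple-unresolved

theorem3p9 : (n k m : ℕ) → .{{_ : NonZero n}} → 2 ∣ n → 4 ≤ n → 3 ≤ k → 2 ≤ m →
    MetricDimension ((Cycle n □ Path k) □ Path m) 4
theorem3p9 _ _ _ (divides h n≡h*2)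
  (s≤s (s≤s (s≤s (s≤s {n = N'} _)))) (s≤s (s≤s (s≤s {n = K'} _))) (s≤s (s≤s {n = M'} _)) =
  (landmarks , refl , landmarks-resolve) , resolving⇒4≤length
  where
    n≡h+h : 4 + N' ≡ h + h
    n≡h+h = trans n≡h*2 (trans (*-comm h 2) (cong (h +_) (+-identityʳ h)))
    open Prism (3 + N') (2 + K') (1 + M') h n≡h+h using (module ResolvingSet)
    open ResolvingSet (s≤s z≤n)
    open NoResolvingTriple N' K' M' h n≡h+h
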